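{- Let $G$ be a connected graph of order $n$ with $k$ cut edges. If $SO(G)$ is maximum among all connected graphs of order $n$ with $k$ cut edges, then every cut edge of $G$ is pendent (i.e., has an endpoint of degree $1$).
   Context: All graphs are finite and simple. A cut edge of a connected graph $G$ is an edge $uv$ such that $G-uv$ is disconnected. For a graph $G$ with edge set $E(G)$ and vertex degrees $d_G(v)$, the Sombor index is $SO(G)=\sum_{uv\in E(G)}\sqrt{d_G(u)^2+d_G(v)^2}$. -}

module Defs where

open import Data.Nat using (ℕ; zero; suc; _+_; _*_; _≤_; _<_; _≤ᵇ_; _<ᵇ_)
open import Data.Bool using (Bool; true; false; if_then_else_; _∧_)
open import Data.Fin using (Fin; toℕ)
open import Data.List using (List; []; _∷_; map; allFin; concatMap; length)
open import Data.Nat.ListAction using (sum)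
open import Data.List.Relation.Unary.All using (All)
open import Data.List.Relation.Unary.Unique.Propositional using (Unique)
open import Data.List.Membership.Propositional using (_∈_)
open import Data.Product using (_×_; _,_; ∃)
open import Data.Sum using (_⊎_)
open import Relation.Nullary using (¬_)
open import Relation.Binary.PropositionalEquality using (_≡_)
open import Relation.Binary.Construct.Closure.ReflexiveTransitive using (Star)
open import Function.Bundles using (_⇔_)

record Graph (n : ℕ) : Set where
  field
    adj    : Fin n → Fin n → Bool
    sym    : ∀ i j → adj i j ≡ adj j i
    irrefl : ∀ i → adj i i ≡ false
open Graph public

Adj : ∀ {n} → Graph n → Fin n → Fin n → Set
Adj G i j = adj G i j ≡ true

Connected : ∀ {n} → Graph n → Set
Connected G = ∀ x y → Star (Adj G) x y

AdjMinus : ∀ {n} → Graph n → Fin n → Fin n → Fin n → Fin n → Set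
AdjMinus G u v i j = Adj G i j × ¬ ((i ≡ u × j ≡ v) ⊎ (i ≡ v × j ≡ u))

IsCutEdge : ∀ {n} → Graph n → Fin n → Fin n → Set
IsCutEdge G u v = Adj G u v × ¬ (∀ x y → Star (AdjMinus G u v) x y)

HasCutEdges : ∀ {n} → Graph n → ℕ → Set
HasCutEdges {n} G k = ∃ λ (L : List (Fin n × Fin n)) →
  length L ≡ k × Unique L ×
  All (λ p → toℕ (Data.Product.proj₁ p) < toℕ (Data.Product.proj₂ p)) L ×
  (∀ i j → toℕ i < toℕ j → (((i , j) ∈ L) ⇔ IsCutEdge G i j))

degree : ∀ {n} → Graph n → Fin n → ℕ
degree {n} G i = sum (map (λ j → if adj G i j then 1 else 0) (allFin n))

edgeWeights : ∀ {n} → Graph n → List ℕ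
edgeWeights {n} G = concatMap (λ i → concatMap (λ j →
  if adj G i j ∧ (toℕ i <ᵇ toℕ j)
  then (degree G i * degree G i + degree G j * degree G j) ∷ []
  else []) (allFin n)) (allFin n)

isqrt : ℕ → ℕ
isqrt zero = 0
isqrt (suc m) with isqrt m
... | r = if suc r * suc r ≤ᵇ suc m then suc r else r

-- lower approximation: sum over edges of floor(N * sqrt w) ; SO = Σ sqrt w
approxSO : ℕ → List ℕ → ℕ
approxSO N ws = sum (map (λ w → isqrt (N * N * w)) ws)

-- SO(H) ≤ SO(G) (as real numbers), expressed exactly via integer approximations:
-- for every N, Σ ⌊N√a⌋ ≤ Σ (⌊N√b⌋ + 1).
_≤SO_ : ∀ {m n} → Graph m → Graph n → Set
H ≤SO G = ∀ N → approxSO N (edgeWeights H) ≤ approxSO N (edgeWeights G) + length (edgeWeights G)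

Pendent : ∀ {n} → Graph n → Fin n → Fin n → Set
Pendent G u v = degree G u ≡ 1 ⊎ degree G v ≡ 1

{-# OPTIONS --safe #-}
-- If a cut edge uv had both end degrees at least 2, slide every edge vw with w ≠ u over to uw.
-- As uv is a cut edge, u and v have no common neighbour, so this gives a simple graph H in which
-- v is a leaf at u, and the induced map E(G) → E(H) is a bijection under which G − e is connected
-- exactly when H minus the image of e is: H is connected and has the same k cut edges. No edge
-- weight d(a)² + d(b)² decreases under the map (for uv: d(u)² + d(v)² ≤ (d(u) + d(v) − 1)² + 1),
-- and the edge from u to a second neighbour x gains strictly, so SO(H) > SO(G). For the integer
-- approximations behind ≤SO, the scale N is taken so large that this gain beats the rounding.
module Submission where

open import Defs hiding (sym)
open import Data.Nat using (ℕ; zero; suc; _+_; _*_; _≤_; _<_; z≤n; s≤s; _≤ᵇ_; _<ᵇ_)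
open import Data.Nat.Properties hiding (_≟_)
import Data.Nat as ℕ
open import Data.Nat.Tactic.RingSolver using (solve-∀)
open import Data.Bool using (Bool; true; false; if_then_else_; T; _∧_; _∨_)
open import Data.Fin using (Fin; zero; suc; toℕ; _≟_)
import Data.Fin.Properties as Finₚ
import Data.Bool.Properties as Boolₚ
open import Data.Vec.Functional using (Vector)
open import Data.List using (List; []; _∷_)
import Data.List as List
import Data.List.Properties as List
open import Data.Nat.ListAction using () renaming (sum to listSum)
open import Data.Nat.ListAction.Properties using (sum-++)
open import Data.List.Relation.Unary.All using (All; []; _∷_)
import Data.List.Relation.Unary.All as All
import Data.List.Relation.Unary.All.Properties as All
open import Data.List.Relation.Unary.AllPairs using ([]; _∷_)
open import Data.List.Relation.Unary.Unique.Propositional using (Unique)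
open import Data.List.Membership.Propositional using (_∈_)
open import Data.List.Membership.Propositional.Properties using (∈-map⁺; ∈-map⁻)
open import Function.Bundles using (_⇔_; mk⇔; Equivalence)
open import Data.Product using (_×_; _,_; ∃; proj₁; proj₂)
import Data.Product as Prod
open import Data.Product.Properties using (,-injective)
open import Data.Sum using (_⊎_; inj₁; inj₂)
import Data.Sum as Sum
open import Data.Empty using (⊥; ⊥-elim)
open import Relation.Binary.Construct.Closure.ReflexiveTransitive using (Star; ε; _◅_; _⋆)
import Relation.Binary.Construct.Closure.ReflexiveTransitive as Star
open import Function using (_∘_; const; id)
open import Relation.Nullary using (¬_; ¬?; Dec; yes; no)
open import Relation.Binary.Definitions using (tri<; tri≈; tri>)
open import Relation.Nullary.Decidable using (_×-dec_; _⊎-dec_)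
open import Relation.Nullary.Reflects using (ofʸ; ofⁿ)
open import Relation.Binary.PropositionalEquality
open import Algebra.Properties.CommutativeMonoid.Sum +-0-commutativeMonoid
  using (sum; sum-syntax; sum-cong-≗; ∑-distrib-+; ∑-comm; sum-replicate-zero)
open import Algebra.Properties.CommutativeSemigroup +-commutativeSemigroup using (xy∙z≈y∙xz; xy∙z≈xz∙y)

isqrt-bounds : ∀ m → isqrt m * isqrt m ≤ m × m < suc (isqrt m) * suc (isqrt m)
isqrt-bounds zero = z≤n , s≤s z≤n
isqrt-bounds (suc m) with isqrt m | isqrt-bounds m
... | r | (r²≤m , m<[1+r]²) with suc r * suc r ≤ᵇ suc m in step
... | true  = ≤ᵇ⇒≤ (suc r * suc r) (suc m) (subst T (sym step) _)
            , ≤-<-trans m<[1+r]² (*-mono-< (n<1+n (suc r)) (n<1+n (suc r)))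
... | false = m≤n⇒m≤1+n r²≤m , ≰⇒> (λ le → subst T step (≤⇒≤ᵇ le))

≤-isqrt : ∀ {s m} → s * s ≤ m → s ≤ isqrt m
≤-isqrt {s} {m} s²≤m = ≮⇒≥ λ r<s →
  <-irrefl refl (<-≤-trans (proj₂ (isqrt-bounds m)) (≤-trans (*-mono-≤ r<s r<s) s²≤m))

isqrt-mono-≤ : ∀ {m m′} → m ≤ m′ → isqrt m ≤ isqrt m′
isqrt-mono-≤ {m} m≤m′ = ≤-isqrt (≤-trans (proj₁ (isqrt-bounds m)) m≤m′)

m*m≤n*n⇒m≤n : ∀ {m n} → m * m ≤ n * n → m ≤ n
m*m≤n*n⇒m≤n m²≤n² = ≮⇒≥ λ n<m → <⇒≱ (*-mono-< n<m n<m) m²≤n²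

sum-of-squares-mono : ∀ {a b a′ b′} → a ≤ a′ → b ≤ b′ → a * a + b * b ≤ a′ * a′ + b′ * b′
sum-of-squares-mono a≤a′ b≤b′ = +-mono-≤ (*-mono-≤ a≤a′ a≤a′) (*-mono-≤ b≤b′ b≤b′)

a²+b²≤c²+1 : ∀ {a b c} → 1 ≤ a → 1 ≤ b → c + 1 ≡ a + b → a * a + b * b ≤ c * c + 1 * 1
a²+b²≤c²+1 {suc p} {suc q} {c} _ _ c+1≡a+b = begin
  suc p * suc p + suc q * suc q                     ≤⟨ m≤m+n _ (2 * p * q) ⟩
  suc p * suc p + suc q * suc q + 2 * p * q         ≡⟨ expand p q ⟩
  (p + q + 1) * (p + q + 1) + 1 * 1                 ≡⟨ cong (λ c → c * c + 1 * 1) c≡p+q+1 ⟨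
  c * c + 1 * 1                                     ∎
  where
  open ≤-Reasoning
  expand : ∀ p q → suc p * suc p + suc q * suc q + 2 * p * q ≡ (p + q + 1) * (p + q + 1) + 1 * 1
  expand = solve-∀
  reassociate : ∀ p q → suc p + suc q ≡ p + q + 1 + 1
  reassociate = solve-∀
  c≡p+q+1 : c ≡ p + q + 1
  c≡p+q+1 = +-cancelʳ-≡ 1 c (p + q + 1) (trans c+1≡a+b (reassociate p q))

scaledRoot : ℕ → ℕ → ℕ
scaledRoot N w = isqrt (N * N * w)

scaledRoot-mono-≤ : ∀ N {w w′} → w ≤ w′ → scaledRoot N w ≤ scaledRoot N w′
scaledRoot-mono-≤ N w≤w′ = isqrt-mono-≤ (*-monoʳ-≤ (N * N) w≤w′)

-- With N = C (2w + 3) and r = ⌊N √w⌋ ≤ N (w + 1), one has (r + C)² ≤ N² w + N².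
scaledRoot-suc-gap : ∀ w C → ∃ λ N → scaledRoot N w + C ≤ scaledRoot N (suc w)
scaledRoot-suc-gap w C = N , ≤-isqrt (begin
    (r + C) * (r + C)               ≡⟨ expand r C ⟩
    r * r + (2 * r * C + C * C)     ≤⟨ +-mono-≤ r²≤N²w (+-mono-≤ (*-monoˡ-≤ C (*-monoʳ-≤ 2 r≤N[w+1])) C²≤CN) ⟩
    N * N * w + (2 * (N * suc w) * C + C * N)  ≡⟨ cong (N * N * w +_) (sym (split N C w)) ⟩
    N * N * w + N * N               ≡⟨ +-comm (N * N) (N * N * w) ⟨
    N * N + N * N * w               ≡⟨ *-suc (N * N) w ⟨
    N * N * suc w                   ∎)
  where
  open ≤-Reasoning
  expand : ∀ r C → (r + C) * (r + C) ≡ r * r + (2 * r * C + C * C)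
  expand = solve-∀
  split : ∀ N C w → N * (C * (3 + 2 * w)) ≡ 2 * (N * suc w) * C + C * N
  split = solve-∀
  sq-expand : ∀ N w → (N * suc w) * (N * suc w) ≡ N * N * w + N * N * (w * w + w + 1)
  sq-expand = solve-∀
  N = C * (3 + 2 * w)
  r = scaledRoot N w
  r²≤N²w : r * r ≤ N * N * w
  r²≤N²w = proj₁ (isqrt-bounds (N * N * w))
  r≤N[w+1] : r ≤ N * suc w
  r≤N[w+1] = m*m≤n*n⇒m≤n (≤-trans r²≤N²w (≤-trans (m≤m+n _ _) (≤-reflexive (sym (sq-expand N w)))))
  C²≤CN : C * C ≤ C * N
  C²≤CN = *-monoʳ-≤ C (m≤m*n C (3 + 2 * w))

scaledRoot-gap : ∀ {w w′} C → w < w′ → ∃ λ N → scaledRoot N w + C ≤ scaledRoot N w′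
scaledRoot-gap {w} C w<w′ with scaledRoot-suc-gap w C
... | N , gap = N , ≤-trans gap (scaledRoot-mono-≤ N w<w′)

sum-mono-≤ : ∀ {n} {f g : Vector ℕ n} → (∀ i → f i ≤ g i) → sum f ≤ sum g
sum-mono-≤ {zero}  f≤g = z≤n
sum-mono-≤ {suc n} f≤g = +-mono-≤ (f≤g zero) (sum-mono-≤ (f≤g ∘ suc))

sum-mono-≤-except : ∀ {n} {f g : Vector ℕ n} {c d} (x : Fin n) →
  f x + c ≤ g x + d → (∀ j → j ≢ x → f j ≤ g j) → sum f + c ≤ sum g + d
sum-mono-≤-except {suc n} {f} {g} {c} {d} zero at-x elsewhere = begin
  f zero + F + c   ≡⟨ xy∙z≈xz∙y (f zero) F c ⟩
  f zero + c + F   ≤⟨ +-mono-≤ at-x (sum-mono-≤ (λ j → elsewhere (suc j) λ ())) ⟩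
  g zero + d + G   ≡⟨ xy∙z≈xz∙y (g zero) G d ⟨
  g zero + G + d   ∎
  where
  open ≤-Reasoning
  F = sum (f ∘ suc)
  G = sum (g ∘ suc)
sum-mono-≤-except {suc n} {f} {g} {c} {d} (suc x) at-x elsewhere = begin
  f zero + F + c   ≡⟨ +-assoc (f zero) F c ⟩
  f zero + (F + c) ≤⟨ +-mono-≤ (elsewhere zero λ ())
                        (sum-mono-≤-except x at-x (λ j j≢x → elsewhere (suc j) (j≢x ∘ Finₚ.suc-injective))) ⟩
  g zero + (G + d) ≡⟨ +-assoc (g zero) G d ⟨
  g zero + G + d   ∎
  where
  open ≤-Reasoning
  F = sum (f ∘ suc)
  G = sum (g ∘ suc)

sum-mono-≤-except₂ : ∀ {n} {f g : Vector ℕ n} {c d} {u v : Fin n} → u ≢ v →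
  f u + f v + c ≤ g u + g v + d → (∀ j → j ≢ u → j ≢ v → f j ≤ g j) → sum f + c ≤ sum g + d
sum-mono-≤-except₂ {u = zero} {zero} u≢v _ _ = ⊥-elim (u≢v refl)
sum-mono-≤-except₂ {suc n} {f} {g} {c} {d} {zero} {suc v} _ at-uv elsewhere = begin
  f zero + F + c   ≡⟨ xy∙z≈y∙xz (f zero) F c ⟩
  F + (f zero + c) ≤⟨ sum-mono-≤-except v (subst₂ _≤_ (xy∙z≈y∙xz (f zero) _ c) (xy∙z≈y∙xz (g zero) _ d) at-uv)
                        (λ j j≢v → elsewhere (suc j) (λ ()) (j≢v ∘ Finₚ.suc-injective)) ⟩
  G + (g zero + d) ≡⟨ xy∙z≈y∙xz (g zero) G d ⟨
  g zero + G + d   ∎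
  where
  open ≤-Reasoning
  F = sum (f ∘ suc)
  G = sum (g ∘ suc)
sum-mono-≤-except₂ {suc n} {f} {g} {c} {d} {suc u} {zero} _ at-uv elsewhere = begin
  f zero + F + c   ≡⟨ xy∙z≈y∙xz (f zero) F c ⟩
  F + (f zero + c) ≤⟨ sum-mono-≤-except u (subst₂ _≤_ (+-assoc _ (f zero) c) (+-assoc _ (g zero) d) at-uv)
                        (λ j j≢u → elsewhere (suc j) (j≢u ∘ Finₚ.suc-injective) (λ ())) ⟩
  G + (g zero + d) ≡⟨ xy∙z≈y∙xz (g zero) G d ⟨
  g zero + G + d   ∎
  where
  open ≤-Reasoning
  F = sum (f ∘ suc)
  G = sum (g ∘ suc)
sum-mono-≤-except₂ {suc n} {f} {g} {c} {d} {suc u} {suc v} u≢v at-uv elsewhere = begin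
  f zero + F + c   ≡⟨ +-assoc (f zero) F c ⟩
  f zero + (F + c) ≤⟨ +-mono-≤ (elsewhere zero (λ ()) (λ ()))
                        (sum-mono-≤-except₂ (u≢v ∘ cong suc) at-uv
                          (λ j j≢u j≢v → elsewhere (suc j) (j≢u ∘ Finₚ.suc-injective) (j≢v ∘ Finₚ.suc-injective))) ⟩
  g zero + (G + d) ≡⟨ +-assoc (g zero) G d ⟨
  g zero + G + d   ∎
  where
  open ≤-Reasoning
  F = sum (f ∘ suc)
  G = sum (g ∘ suc)

sum-cong-except : ∀ {n} {f g : Vector ℕ n} {c d} (x : Fin n) →
  f x + c ≡ g x + d → (∀ j → j ≢ x → f j ≡ g j) → sum f + c ≡ sum g + d
sum-cong-except x at-x elsewhere = ≤-antisym
  (sum-mono-≤-except x (≤-reflexive at-x) (λ j j≢x → ≤-reflexive (elsewhere j j≢x)))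
  (sum-mono-≤-except x (≤-reflexive (sym at-x)) (λ j j≢x → ≤-reflexive (sym (elsewhere j j≢x))))

sum-cong-except₂ : ∀ {n} {f g : Vector ℕ n} {c d} {u v : Fin n} → u ≢ v →
  f u + f v + c ≡ g u + g v + d → (∀ j → j ≢ u → j ≢ v → f j ≡ g j) → sum f + c ≡ sum g + d
sum-cong-except₂ u≢v at-uv elsewhere = ≤-antisym
  (sum-mono-≤-except₂ u≢v (≤-reflexive at-uv) (λ j j≢u j≢v → ≤-reflexive (elsewhere j j≢u j≢v)))
  (sum-mono-≤-except₂ u≢v (≤-reflexive (sym at-uv)) (λ j j≢u j≢v → ≤-reflexive (sym (elsewhere j j≢u j≢v))))

listSum-tabulate : ∀ {n} (f : Fin n → ℕ) → listSum (List.tabulate f) ≡ sum f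
listSum-tabulate {zero}  f = refl
listSum-tabulate {suc n} f = cong (f zero +_) (listSum-tabulate (f ∘ suc))

listSum-map-allFin : ∀ {n} (f : Fin n → ℕ) → listSum (List.map f (List.allFin n)) ≡ sum f
listSum-map-allFin f = trans (cong listSum (List.map-tabulate id f)) (listSum-tabulate f)

listSum-concat : ∀ (xss : List (List ℕ)) → listSum (List.concat xss) ≡ listSum (List.map listSum xss)
listSum-concat []         = refl
listSum-concat (xs ∷ xss) = trans (sum-++ xs (List.concat xss)) (cong (listSum xs +_) (listSum-concat xss))

listSum-map-concatMap : ∀ {A : Set} (F : ℕ → ℕ) (g : A → List ℕ) xs →
  listSum (List.map F (List.concatMap g xs)) ≡ listSum (List.map (listSum ∘ List.map F ∘ g) xs)
listSum-map-concatMap F g xs = begin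
  listSum (List.map F (List.concatMap g xs))              ≡⟨ cong listSum (List.map-concatMap F g xs) ⟩
  listSum (List.concat (List.map (List.map F ∘ g) xs))    ≡⟨ listSum-concat (List.map (List.map F ∘ g) xs) ⟩
  listSum (List.map listSum (List.map (List.map F ∘ g) xs)) ≡⟨ cong listSum (List.map-∘ xs) ⟨
  listSum (List.map (listSum ∘ List.map F ∘ g) xs)        ∎
  where open ≡-Reasoning

upperPart : ∀ {n} → (Fin n → Fin n → ℕ) → Fin n → Fin n → ℕ
upperPart Φ i j = if toℕ i <ᵇ toℕ j then Φ i j else 0

upperPart-split : ∀ {n} (Φ : Fin n → Fin n → ℕ) → (∀ i j → Φ i j ≡ Φ j i) → (∀ i → Φ i i ≡ 0) →
  ∀ i j → Φ i j ≡ upperPart Φ i j + upperPart Φ j i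
upperPart-split Φ Φ-sym Φ-diag i j
  with toℕ i <ᵇ toℕ j | <ᵇ-reflects-< (toℕ i) (toℕ j) | toℕ j <ᵇ toℕ i | <ᵇ-reflects-< (toℕ j) (toℕ i)
... | true  | ofʸ i<j  | true  | ofʸ j<i  = ⊥-elim (<-asym i<j j<i)
... | true  | _        | false | _        = sym (+-identityʳ (Φ i j))
... | false | _        | true  | _        = Φ-sym i j
... | false | ofⁿ i≮j  | false | ofⁿ j≮i  =
  trans (cong (Φ i) (sym (Finₚ.toℕ-injective (≤-antisym (≮⇒≥ j≮i) (≮⇒≥ i≮j))))) (Φ-diag i)

∑∑-symmetric : ∀ {n} (Φ : Fin n → Fin n → ℕ) → (∀ i j → Φ i j ≡ Φ j i) → (∀ i → Φ i i ≡ 0) →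
  ∑[ i < n ] ∑[ j < n ] Φ i j ≡ 2 * ∑[ i < n ] ∑[ j < n ] upperPart Φ i j
∑∑-symmetric {n} Φ Φ-sym Φ-diag = begin
  ∑[ i < n ] ∑[ j < n ] Φ i j
    ≡⟨ sum-cong-≗ (λ i → sum-cong-≗ (upperPart-split Φ Φ-sym Φ-diag i)) ⟩
  ∑[ i < n ] ∑[ j < n ] (U i j + U j i)
    ≡⟨ sum-cong-≗ (λ i → ∑-distrib-+ (U i) (λ j → U j i)) ⟩
  ∑[ i < n ] (∑[ j < n ] U i j + ∑[ j < n ] U j i)
    ≡⟨ ∑-distrib-+ (λ i → sum (U i)) (λ i → ∑[ j < n ] U j i) ⟩
  S + ∑[ i < n ] ∑[ j < n ] U j i  ≡⟨ cong (S +_) (∑-comm U) ⟨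
  S + S                            ≡⟨ cong (S +_) (+-identityʳ S) ⟨
  2 * S                            ∎
  where
  open ≡-Reasoning
  U = upperPart Φ
  S = ∑[ i < n ] ∑[ j < n ] U i j

if-∨-disjoint : ∀ {a b} z → (a ≡ true → b ≡ true → ⊥) →
  (if a ∨ b then z else 0) ≡ (if a then z else 0) + (if b then z else 0)
if-∨-disjoint {true}  {true}  z disjoint = ⊥-elim (disjoint refl refl)
if-∨-disjoint {true}  {false} z disjoint = sym (+-identityʳ z)
if-∨-disjoint {false}         z disjoint = refl

indicator : Bool → ℕ
indicator b = if b then 1 else 0

∨≡true⇒⊎ : ∀ {a b} → a ∨ b ≡ true → a ≡ true ⊎ b ≡ true
∨≡true⇒⊎ {true}  _      = inj₁ refl
∨≡true⇒⊎ {false} b≡true = inj₂ b≡true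

Adj⇒≢ : ∀ {n} (X : Graph n) {a b} → Adj X a b → a ≢ b
Adj⇒≢ X {a} ab refl with trans (sym ab) (irrefl X a)
... | ()

Adj-sym : ∀ {n} (X : Graph n) {a b} → Adj X a b → Adj X b a
Adj-sym X {a} {b} ab = trans (Graph.sym X b a) ab

adjIndicator : ∀ {n} → Graph n → Fin n → Fin n → ℕ
adjIndicator X i j = indicator (adj X i j)

degree-as-sum : ∀ {n} (X : Graph n) i → degree X i ≡ sum (adjIndicator X i)
degree-as-sum X i = listSum-map-allFin (adjIndicator X i)

adj-false : ∀ {n} (X : Graph n) {i j} → ¬ Adj X i j → adj X i j ≡ false
adj-false X {i} {j} ¬ij with adj X i j
... | true  = ⊥-elim (¬ij refl)
... | false = refl

adjIndicator-true : ∀ {n} (X : Graph n) {i j} → Adj X i j → adjIndicator X i j ≡ 1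
adjIndicator-true X ij rewrite ij = refl

adjIndicator-false : ∀ {n} (X : Graph n) {i j} → ¬ Adj X i j → adjIndicator X i j ≡ 0
adjIndicator-false X ¬ij = cong indicator (adj-false X ¬ij)

Adj⇒1≤degree : ∀ {n} (X : Graph n) {i j} → Adj X i j → 1 ≤ degree X i
Adj⇒1≤degree {n} X {i} {j} ij = begin
  1                                 ≡⟨ cong (_+ 1) (sum-replicate-zero n) ⟨
  sum {n} (const 0) + 1             ≤⟨ sum-mono-≤-except j
                                         (≤-reflexive (trans (sym (adjIndicator-true X ij)) (sym (+-identityʳ _))))
                                         (λ _ _ → z≤n) ⟩
  sum (adjIndicator X i) + 0        ≡⟨ +-identityʳ _ ⟩
  sum (adjIndicator X i)            ≡⟨ degree-as-sum X i ⟨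
  degree X i                        ∎
  where open ≤-Reasoning

degree-unique-neighbour : ∀ {n} (X : Graph n) {i j} → Adj X i j → (∀ k → Adj X i k → k ≡ j) → degree X i ≡ 1
degree-unique-neighbour {n} X {i} {j} ij unique = begin
  degree X i                  ≡⟨ degree-as-sum X i ⟩
  sum (adjIndicator X i)      ≡⟨ +-identityʳ _ ⟨
  sum (adjIndicator X i) + 0  ≡⟨ sum-cong-except j (trans (+-identityʳ _) (adjIndicator-true X ij))
                                   (λ k k≢j → adjIndicator-false X (k≢j ∘ unique k)) ⟩
  sum {n} (const 0) + 1       ≡⟨ cong (_+ 1) (sum-replicate-zero n) ⟩
  1                           ∎
  where open ≡-Reasoning

degree≢1⇒other-neighbour : ∀ {n} (X : Graph n) {i j} → Adj X i j → degree X i ≢ 1 → ∃ λ k → Adj X i k × k ≢ j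
degree≢1⇒other-neighbour X {i} {j} ij deg≢1
  with Finₚ.any? (λ k → (adj X i k Boolₚ.≟ true) ×-dec ¬? (k ≟ j))
... | yes (k , ik , k≢j) = k , ik , k≢j
... | no none = ⊥-elim (deg≢1 (degree-unique-neighbour X ij unique))
  where
  unique : ∀ k → Adj X i k → k ≡ j
  unique k ik with k ≟ j
  ... | yes k≡j = k≡j
  ... | no k≢j  = ⊥-elim (none (k , ik , k≢j))

SameEdge : ∀ {n} → Fin n → Fin n → Fin n → Fin n → Set
SameEdge a b s t = (s ≡ a × t ≡ b) ⊎ (s ≡ b × t ≡ a)

sameEdge? : ∀ {n} (a b s t : Fin n) → Dec (SameEdge a b s t)
sameEdge? a b s t = (s ≟ a ×-dec t ≟ b) ⊎-dec (s ≟ b ×-dec t ≟ a)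

SameEdge-comm : ∀ {n} {a b s t : Fin n} → SameEdge a b s t → SameEdge s t a b
SameEdge-comm (inj₁ (s≡a , t≡b)) = inj₁ (sym s≡a , sym t≡b)
SameEdge-comm (inj₂ (s≡b , t≡a)) = inj₂ (sym t≡a , sym s≡b)

SameEdge-flip : ∀ {n} {a b s t : Fin n} → SameEdge a b s t → SameEdge a b t s
SameEdge-flip = Sum.swap ∘ Sum.map Prod.swap Prod.swap

ConnectedWithout : ∀ {n} → Graph n → Fin n → Fin n → Set
ConnectedWithout X a b = ∀ x y → Star (AdjMinus X a b) x y

ConnectedWithout-sym : ∀ {n} (X : Graph n) {a b} → ConnectedWithout X a b → ConnectedWithout X b a
ConnectedWithout-sym X conn x y = Star.map (λ (st , ¬ab) → st , ¬ab ∘ Sum.swap) (conn x y)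

IsCutEdge-sym : ∀ {n} (X : Graph n) {a b} → IsCutEdge X a b → IsCutEdge X b a
IsCutEdge-sym X (ab , ¬conn) = Adj-sym X ab , ¬conn ∘ ConnectedWithout-sym X

leaf-IsCutEdge : ∀ {n} (X : Graph n) {a b} → Adj X a b → (∀ {k} → Adj X a k → k ≡ b) → IsCutEdge X a b
leaf-IsCutEdge X {a} {b} ab leaf = ab , λ conn → Adj⇒≢ X ab (sym (stuck (conn a b)))
  where
  stuck : ∀ {y} → Star (AdjMinus X a b) a y → y ≡ a
  stuck ε                = refl
  stuck ((ak , ¬ab) ◅ _) = ⊥-elim (¬ab (inj₁ (refl , leaf ak)))

IsCutEdge⇒no-common-neighbour : ∀ {n} (X : Graph n) {u v w} → Connected X → IsCutEdge X u v →
  Adj X u w → Adj X v w → ⊥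
IsCutEdge⇒no-common-neighbour X {u} {v} {w} conn (uv , ¬conn) uw vw = ¬conn λ x y → (detour ⋆) (conn x y)
  where
  u≢v = Adj⇒≢ X uv
  w≢u = Adj⇒≢ X (Adj-sym X uw)
  w≢v = Adj⇒≢ X (Adj-sym X vw)
  u–w : AdjMinus X u v u w
  u–w = uw , λ { (inj₁ (_ , w≡v)) → w≢v w≡v ; (inj₂ (u≡v , _)) → u≢v u≡v }
  w–v : AdjMinus X u v w v
  w–v = Adj-sym X vw , λ { (inj₁ (w≡u , _)) → w≢u w≡u ; (inj₂ (w≡v , _)) → w≢v w≡v }
  v–w : AdjMinus X u v v w
  v–w = vw , λ { (inj₁ (v≡u , _)) → u≢v (sym v≡u) ; (inj₂ (_ , w≡u)) → w≢u w≡u }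
  w–u : AdjMinus X u v w u
  w–u = Adj-sym X uw , λ { (inj₁ (w≡u , _)) → w≢u w≡u ; (inj₂ (w≡v , _)) → w≢v w≡v }
  detour : ∀ {s t} → Adj X s t → Star (AdjMinus X u v) s t
  detour {s} {t} st with sameEdge? u v s t
  ... | yes (inj₁ (refl , refl)) = u–w ◅ w–v ◅ ε
  ... | yes (inj₂ (refl , refl)) = v–w ◅ w–u ◅ ε
  ... | no ¬uv                   = (st , ¬uv) ◅ ε

Sorted : ∀ {n} → Fin n × Fin n → Set
Sorted (i , j) = toℕ i < toℕ j

sortPair : ∀ {n} → Fin n → Fin n → Fin n × Fin n
sortPair s t with toℕ s <? toℕ t
... | yes _ = s , t
... | no _  = t , s

sortPair-< : ∀ {n} {s t : Fin n} → toℕ s < toℕ t → sortPair s t ≡ (s , t)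
sortPair-< {s = s} {t} s<t with toℕ s <? toℕ t
... | yes _  = refl
... | no s≮t = ⊥-elim (s≮t s<t)

sortPair-> : ∀ {n} {s t : Fin n} → toℕ t < toℕ s → sortPair s t ≡ (t , s)
sortPair-> {s = s} {t} t<s with toℕ s <? toℕ t
... | yes s<t = ⊥-elim (<-asym s<t t<s)
... | no _    = refl

sortPair-cases : ∀ {n} (s t : Fin n) → sortPair s t ≡ (s , t) ⊎ sortPair s t ≡ (t , s)
sortPair-cases s t with toℕ s <? toℕ t
... | yes _ = inj₁ refl
... | no _  = inj₂ refl

sortPair-sorted : ∀ {n} {s t : Fin n} → s ≢ t → Sorted (sortPair s t)
sortPair-sorted {s = s} {t} s≢t with toℕ s <? toℕ t
... | yes s<t = s<t
... | no s≮t  = ≤∧≢⇒< (≮⇒≥ s≮t) (s≢t ∘ sym ∘ Finₚ.toℕ-injective)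

HasPairs : ∀ {n} → (Fin n → Fin n → Set) → ℕ → Set
HasPairs {n} P k = ∃ λ (L : List (Fin n × Fin n)) →
  List.length L ≡ k × Unique L × All Sorted L × (∀ i j → toℕ i < toℕ j → ((i , j) ∈ L) ⇔ P i j)

Unique-map⁺-on : ∀ {A B : Set} {P : A → Set} {f : A → B} →
  (∀ {x y} → P x → P y → f x ≡ f y → x ≡ y) → ∀ {xs} → All P xs → Unique xs → Unique (List.map f xs)
Unique-map⁺-on inj []         []           = []
Unique-map⁺-on inj (px ∷ pxs) (x∉xs ∷ uxs) =
  All.map⁺ (All.zipWith (λ (x≢y , py) fx≡fy → x≢y (inj px py fx≡fy)) (x∉xs , pxs)) ∷ Unique-map⁺-on inj pxs uxs

module _ {n} {P Q : Fin n → Fin n → Set} (σ : Fin n → Fin n → Fin n)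
         (P-sym : ∀ {a b} → P a b → P b a)
         (Q-irrefl : ∀ {s t} → Q s t → s ≢ t)
         (σ-map : ∀ {a b} → P a b → Q (σ a b) (σ b a))
         (σ-injective : ∀ {a b c d} → P a b → P c d → σ a b ≡ σ c d → σ b a ≡ σ d c → a ≡ c × b ≡ d)
         (σ-onto : ∀ {s t} → Q s t → ∃ λ c → ∃ λ d → P c d × σ c d ≡ s × σ d c ≡ t) where

  private
    image : Fin n × Fin n → Fin n × Fin n
    image (c , d) = sortPair (σ c d) (σ d c)

    SortedP : Fin n × Fin n → Set
    SortedP (c , d) = P c d × toℕ c < toℕ d

    aligned : ∀ {c d c′ d′} → P c d → P c′ d′ →
              σ c d ≡ σ c′ d′ × σ d c ≡ σ d′ c′ → (c , d) ≡ (c′ , d′)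
    aligned cd cd′ (e₁ , e₂) with σ-injective cd cd′ e₁ e₂
    ... | refl , refl = refl

    crossed : ∀ {c d c′ d′} → SortedP (c , d) → SortedP (c′ , d′) →
              σ c d ≡ σ d′ c′ × σ d c ≡ σ c′ d′ → ⊥
    crossed (cd , c<d) (cd′ , c′<d′) (e₁ , e₂) with σ-injective cd (P-sym cd′) e₁ e₂
    ... | refl , refl = <-asym c<d c′<d′

    image-injective : ∀ {p q} → SortedP p → SortedP q → image p ≡ image q → p ≡ q
    image-injective {c , d} {c′ , d′} p@(cd , _) q@(cd′ , _) eq
      with sortPair-cases (σ c d) (σ d c) | sortPair-cases (σ c′ d′) (σ d′ c′)
    ... | inj₁ e | inj₁ e′ = aligned cd cd′ (,-injective (trans (sym e) (trans eq e′)))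
    ... | inj₂ e | inj₂ e′ = aligned cd cd′ (Prod.swap (,-injective (trans (sym e) (trans eq e′))))
    ... | inj₁ e | inj₂ e′ = ⊥-elim (crossed p q (,-injective (trans (sym e) (trans eq e′))))
    ... | inj₂ e | inj₁ e′ = ⊥-elim (crossed p q (Prod.swap (,-injective (trans (sym e) (trans eq e′)))))

    image-sorted : ∀ {p} → SortedP p → Sorted (image p)
    image-sorted (cd , _) = sortPair-sorted (Q-irrefl (σ-map cd))

    image-Q : ∀ {p} → SortedP p → Q (proj₁ (image p)) (proj₂ (image p))
    image-Q {c , d} (cd , _) with sortPair-cases (σ c d) (σ d c)
    ... | inj₁ e = subst (λ p → Q (proj₁ p) (proj₂ p)) (sym e) (σ-map cd)
    ... | inj₂ e = subst (λ p → Q (proj₁ p) (proj₂ p)) (sym e) (σ-map (P-sym cd))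

  HasPairs-transfer : ∀ {k} → HasPairs P k → HasPairs Q k
  HasPairs-transfer (L , |L|≡k , unique , sorted , L⇔P) =
    List.map image L , trans (List.length-map image L) |L|≡k ,
    Unique-map⁺-on image-injective members unique ,
    All.map⁺ (All.map image-sorted members) , image-L⇔Q
    where
    members : All SortedP L
    members = All.tabulate λ {p} p∈L →
      Equivalence.to (L⇔P (proj₁ p) (proj₂ p) (All.lookup sorted p∈L)) p∈L , All.lookup sorted p∈L

    image-L⇔Q : ∀ i j → toℕ i < toℕ j → ((i , j) ∈ List.map image L) ⇔ Q i j
    image-L⇔Q i j i<j = mk⇔ to from
      where
      to : (i , j) ∈ List.map image L → Q i j
      to ij∈ with ∈-map⁻ image ij∈
      ... | p , p∈L , refl = image-Q (All.lookup members p∈L)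

      from : Q i j → (i , j) ∈ List.map image L
      from ij with σ-onto ij
      ... | c , d , cd , refl , refl with <-cmp (toℕ c) (toℕ d)
      ... | tri< c<d _ _ = subst (_∈ List.map image L) (sortPair-< i<j)
                             (∈-map⁺ image (Equivalence.from (L⇔P c d c<d) cd))
      ... | tri> _ _ d<c = subst (_∈ List.map image L) (sortPair-> i<j)
                             (∈-map⁺ image (Equivalence.from (L⇔P d c d<c) (P-sym cd)))
      ... | tri≈ _ c≡d _ = ⊥-elim (<-irrefl (cong toℕ (cong₂ σ c≡d′ (sym c≡d′))) i<j)
        where c≡d′ = Finₚ.toℕ-injective c≡d

weight : ∀ {n} → Graph n → Fin n → Fin n → ℕ
weight X i j = degree X i * degree X i + degree X j * degree X j

listSum-edgeWeights : ∀ {n} (F : ℕ → ℕ) (X : Graph n) → listSum (List.map F (edgeWeights X)) ≡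
  ∑[ i < n ] ∑[ j < n ] (if adj X i j ∧ (toℕ i <ᵇ toℕ j) then F (weight X i j) else 0)
listSum-edgeWeights {n} F X = begin
  listSum (List.map F (edgeWeights X))
    ≡⟨ listSum-map-concatMap F row (List.allFin n) ⟩
  listSum (List.map (λ i → listSum (List.map F (row i))) (List.allFin n))
    ≡⟨ listSum-map-allFin (λ i → listSum (List.map F (row i))) ⟩
  ∑[ i < n ] listSum (List.map F (row i))
    ≡⟨ sum-cong-≗ (λ i → listSum-map-concatMap F (entry i) (List.allFin n)) ⟩
  ∑[ i < n ] listSum (List.map (λ j → listSum (List.map F (entry i j))) (List.allFin n))
    ≡⟨ sum-cong-≗ (λ i → listSum-map-allFin (λ j → listSum (List.map F (entry i j)))) ⟩
  ∑[ i < n ] ∑[ j < n ] listSum (List.map F (entry i j))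
    ≡⟨ sum-cong-≗ (λ i → sum-cong-≗ (λ j → listSum-singleton (adj X i j ∧ (toℕ i <ᵇ toℕ j)))) ⟩
  ∑[ i < n ] ∑[ j < n ] (if adj X i j ∧ (toℕ i <ᵇ toℕ j) then F (weight X i j) else 0) ∎
  where
  open ≡-Reasoning
  entry : Fin n → Fin n → List ℕ
  entry i j = if adj X i j ∧ (toℕ i <ᵇ toℕ j) then weight X i j ∷ [] else []
  row : Fin n → List ℕ
  row i = List.concatMap (entry i) (List.allFin n)
  listSum-singleton : ∀ {w} b → listSum (List.map F (if b then w ∷ [] else [])) ≡ (if b then F w else 0)
  listSum-singleton true  = +-identityʳ _
  listSum-singleton false = refl

rootIf : ℕ → Bool → ℕ → ℕ
rootIf N b w = if b then scaledRoot N w else 0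

edgeTerm : ∀ {n} → ℕ → Graph n → Fin n → Fin n → ℕ
edgeTerm N X i j = rootIf N (adj X i j) (weight X i j)

edgeTerm-sym : ∀ {n} N (X : Graph n) i j → edgeTerm N X i j ≡ edgeTerm N X j i
edgeTerm-sym N X i j = cong₂ (rootIf N) (Graph.sym X i j) (+-comm (degree X i * degree X i) _)

edgeTerm-diag : ∀ {n} N (X : Graph n) i → edgeTerm N X i i ≡ 0
edgeTerm-diag N X i = cong (λ b → rootIf N b (weight X i i)) (irrefl X i)

approxSO-as-∑∑ : ∀ {n} N (X : Graph n) → 2 * approxSO N (edgeWeights X) ≡ ∑[ i < n ] ∑[ j < n ] edgeTerm N X i j
approxSO-as-∑∑ {n} N X = begin
  2 * approxSO N (edgeWeights X)                       ≡⟨ cong (2 *_) (listSum-edgeWeights (scaledRoot N) X) ⟩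
  2 * ∑[ i < n ] ∑[ j < n ] (if adj X i j ∧ (toℕ i <ᵇ toℕ j) then scaledRoot N (weight X i j) else 0)
      ≡⟨ cong (2 *_) (sum-cong-≗ (λ i → sum-cong-≗ (λ j → if-∧ (adj X i j) (toℕ i <ᵇ toℕ j)))) ⟩
  2 * ∑[ i < n ] ∑[ j < n ] upperPart (edgeTerm N X) i j
      ≡⟨ ∑∑-symmetric (edgeTerm N X) (edgeTerm-sym N X) (edgeTerm-diag N X) ⟨
  ∑[ i < n ] ∑[ j < n ] edgeTerm N X i j              ∎
  where
  open ≡-Reasoning
  if-∧ : ∀ {w} a b → (if a ∧ b then w else 0) ≡ (if b then (if a then w else 0) else 0)
  if-∧ true  b     = refl
  if-∧ false true  = refl
  if-∧ false false = refl

edgeTerm-diag-≤ : ∀ {m n} N (X : Graph m) (Y : Graph n) i j → edgeTerm N X i i ≤ edgeTerm N Y j j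
edgeTerm-diag-≤ N X Y i j = ≤-trans (≤-reflexive (edgeTerm-diag N X i)) z≤n

rootIf-mono : ∀ N {a b w w′} → (a ≡ true → b ≡ true) → w ≤ w′ → rootIf N a w ≤ rootIf N b w′
rootIf-mono N {false} _ _ = z≤n
rootIf-mono N {true} a⇒b w≤w′ rewrite a⇒b refl = scaledRoot-mono-≤ N w≤w′

rootIf-∨ : ∀ N {a b w₁ w₂ w} → (a ≡ true → b ≡ true → ⊥) → w₁ ≤ w → w₂ ≤ w →
  rootIf N a w₁ + rootIf N b w₂ ≤ rootIf N (a ∨ b) w
rootIf-∨ N {a} {b} {w = w} disjoint w₁≤w w₂≤w = begin
  rootIf N a _ + rootIf N b _  ≤⟨ +-mono-≤ (rootIf-mono N {a} id w₁≤w) (rootIf-mono N {b} id w₂≤w) ⟩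
  rootIf N a w + rootIf N b w  ≡⟨ if-∨-disjoint (scaledRoot N w) disjoint ⟨
  rootIf N (a ∨ b) w           ∎
  where open ≤-Reasoning

-- Sliding the edges at v over to u

module Slide {n} (G : Graph n) {u v : Fin n} (uv : Adj G u v)
             (no-common : ∀ {w} → Adj G u w → Adj G v w → ⊥) where

  u≢v : u ≢ v
  u≢v = Adj⇒≢ G uv

  data Role (i : Fin n) : Set where
    is-u  : i ≡ u → Role i
    is-v  : i ≡ v → Role i
    other : i ≢ u → i ≢ v → Role i

  role : ∀ i → Role i
  role i with i ≟ u | i ≟ v
  ... | yes i≡u | _       = is-u i≡u
  ... | no _    | yes i≡v = is-v i≡v
  ... | no i≢u  | no i≢v  = other i≢u i≢v

  slideAdj : Fin n → Fin n → Bool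
  slideAdj i j with role i | role j
  ... | is-u _    | is-u _    = false
  ... | is-u _    | is-v _    = true
  ... | is-u _    | other _ _ = adj G u j ∨ adj G v j
  ... | is-v _    | is-u _    = true
  ... | is-v _    | is-v _    = false
  ... | is-v _    | other _ _ = false
  ... | other _ _ | is-u _    = adj G i u ∨ adj G i v
  ... | other _ _ | is-v _    = false
  ... | other _ _ | other _ _ = adj G i j

  slideAdj-sym : ∀ i j → slideAdj i j ≡ slideAdj j i
  slideAdj-sym i j with role i | role j
  ... | is-u _    | is-u _    = refl
  ... | is-u _    | is-v _    = refl
  ... | is-u _    | other _ _ = cong₂ _∨_ (Graph.sym G u j) (Graph.sym G v j)
  ... | is-v _    | is-u _    = refl
  ... | is-v _    | is-v _    = refl
  ... | is-v _    | other _ _ = refl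
  ... | other _ _ | is-u _    = cong₂ _∨_ (Graph.sym G i u) (Graph.sym G i v)
  ... | other _ _ | is-v _    = refl
  ... | other _ _ | other _ _ = Graph.sym G i j

  slideAdj-irrefl : ∀ i → slideAdj i i ≡ false
  slideAdj-irrefl i with role i
  ... | is-u _    = refl
  ... | is-v _    = refl
  ... | other _ _ = irrefl G i

  H : Graph n
  H = record { adj = slideAdj ; sym = slideAdj-sym ; irrefl = slideAdj-irrefl }

  H-adj-uv : Adj H u v
  H-adj-uv with role u | role v
  ... | is-u _      | is-v _      = refl
  ... | is-u _      | is-u v≡u    = ⊥-elim (u≢v (sym v≡u))
  ... | is-u _      | other _ v≢v = ⊥-elim (v≢v refl)
  ... | is-v u≡v    | _           = ⊥-elim (u≢v u≡v)
  ... | other u≢u _ | _           = ⊥-elim (u≢u refl)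

  H-adj-v : ∀ {j} → Adj H v j → j ≡ u
  H-adj-v {j} vj with role v | role j
  ... | is-v _      | is-u j≡u = j≡u
  ... | is-u v≡u    | _        = ⊥-elim (u≢v (sym v≡u))
  ... | other _ v≢v | _        = ⊥-elim (v≢v refl)
  H-adj-v () | is-v _ | is-v _
  H-adj-v () | is-v _ | other _ _

  H-adj-u-other : ∀ {j} → j ≢ u → j ≢ v → adj H u j ≡ adj G u j ∨ adj G v j
  H-adj-u-other {j} j≢u j≢v with role u | role j
  ... | is-u _      | other _ _ = refl
  ... | is-u _      | is-u j≡u  = ⊥-elim (j≢u j≡u)
  ... | is-u _      | is-v j≡v  = ⊥-elim (j≢v j≡v)
  ... | is-v u≡v    | _         = ⊥-elim (u≢v u≡v)
  ... | other u≢u _ | _         = ⊥-elim (u≢u refl)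

  H-adj-other-u : ∀ {i} → i ≢ u → i ≢ v → adj H i u ≡ adj G i u ∨ adj G i v
  H-adj-other-u {i} i≢u i≢v = begin
    adj H i u               ≡⟨ slideAdj-sym i u ⟩
    adj H u i               ≡⟨ H-adj-u-other i≢u i≢v ⟩
    adj G u i ∨ adj G v i   ≡⟨ cong₂ _∨_ (Graph.sym G u i) (Graph.sym G v i) ⟩
    adj G i u ∨ adj G i v   ∎
    where open ≡-Reasoning

  H-adj-other-v : ∀ {i} → i ≢ u → adj H i v ≡ false
  H-adj-other-v {i} i≢u with role i | role v
  ... | is-v _    | is-v _      = refl
  ... | other _ _ | is-v _      = refl
  ... | is-u i≡u  | _           = ⊥-elim (i≢u i≡u)
  ... | _         | is-u v≡u    = ⊥-elim (u≢v (sym v≡u))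
  ... | _         | other _ v≢v = ⊥-elim (v≢v refl)

  H-adj-other : ∀ {i j} → i ≢ u → i ≢ v → j ≢ u → j ≢ v → adj H i j ≡ adj G i j
  H-adj-other {i} {j} i≢u i≢v j≢u j≢v with role i | role j
  ... | other _ _ | other _ _ = refl
  ... | is-u i≡u  | _         = ⊥-elim (i≢u i≡u)
  ... | is-v i≡v  | _         = ⊥-elim (i≢v i≡v)
  ... | other _ _ | is-u j≡u  = ⊥-elim (j≢u j≡u)
  ... | other _ _ | is-v j≡v  = ⊥-elim (j≢v j≡v)

  no-common′ : ∀ {i} → Adj G i u → Adj G i v → ⊥
  no-common′ iu iv = no-common (Adj-sym G iu) (Adj-sym G iv)

  degree-H-v : degree H v ≡ 1
  degree-H-v = degree-unique-neighbour H {v} {u} (Adj-sym H {u} {v} H-adj-uv) (λ k → H-adj-v {k})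

  degree-H-other : ∀ {i} → i ≢ u → i ≢ v → degree H i ≡ degree G i
  degree-H-other {i} i≢u i≢v = begin
    degree H i                  ≡⟨ degree-as-sum H i ⟩
    sum (adjIndicator H i)      ≡⟨ +-identityʳ _ ⟨
    sum (adjIndicator H i) + 0  ≡⟨ sum-cong-except₂ u≢v (cong (_+ 0) at-uv)
                                     (λ j j≢u j≢v → cong indicator (H-adj-other i≢u i≢v j≢u j≢v)) ⟩
    sum (adjIndicator G i) + 0  ≡⟨ +-identityʳ _ ⟩
    sum (adjIndicator G i)      ≡⟨ degree-as-sum G i ⟨
    degree G i                  ∎
    where
    open ≡-Reasoning
    at-uv : adjIndicator H i u + adjIndicator H i v ≡ adjIndicator G i u + adjIndicator G i v
    at-uv = begin
      indicator (adj H i u) + indicator (adj H i v)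
        ≡⟨ cong₂ _+_ (cong indicator (H-adj-other-u i≢u i≢v)) (cong indicator (H-adj-other-v i≢u)) ⟩
      indicator (adj G i u ∨ adj G i v) + 0         ≡⟨ +-identityʳ _ ⟩
      indicator (adj G i u ∨ adj G i v)             ≡⟨ if-∨-disjoint 1 no-common′ ⟩
      indicator (adj G i u) + indicator (adj G i v) ∎

  degree-H-u : degree H u + 1 ≡ degree G u + degree G v
  degree-H-u = begin
    degree H u + 1                                      ≡⟨ cong (_+ 1) (degree-as-sum H u) ⟩
    sum (adjIndicator H u) + 1                          ≡⟨ sum-cong-except₂ u≢v at-uv elsewhere ⟩
    ∑[ j < n ] (adjIndicator G u j + adjIndicator G v j) + 0 ≡⟨ +-identityʳ _ ⟩
    ∑[ j < n ] (adjIndicator G u j + adjIndicator G v j) ≡⟨ ∑-distrib-+ (adjIndicator G u) (adjIndicator G v) ⟩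
    sum (adjIndicator G u) + sum (adjIndicator G v)      ≡⟨ cong₂ _+_ (degree-as-sum G u) (degree-as-sum G v) ⟨
    degree G u + degree G v                             ∎
    where
    open ≡-Reasoning
    at-uv : adjIndicator H u u + adjIndicator H u v + 1
          ≡ (adjIndicator G u u + adjIndicator G v u) + (adjIndicator G u v + adjIndicator G v v) + 0
    at-uv = trans (cong₂ (λ a b → a + b + 1) (cong indicator (irrefl H u)) (adjIndicator-true H {u} {v} H-adj-uv))
                  (sym (cong₂ (λ a b → a + b + 0)
                         (cong₂ _+_ (cong indicator (irrefl G u)) (adjIndicator-true G (Adj-sym G uv)))
                         (cong₂ _+_ (adjIndicator-true G uv) (cong indicator (irrefl G v)))))
    elsewhere : ∀ j → j ≢ u → j ≢ v → adjIndicator H u j ≡ adjIndicator G u j + adjIndicator G v j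
    elsewhere j j≢u j≢v = trans (cong indicator (H-adj-u-other j≢u j≢v)) (if-∨-disjoint 1 no-common)

  degree-G-u≤H-u : degree G u ≤ degree H u
  degree-G-u≤H-u = +-cancelʳ-≤ 1 _ _ (begin
    degree G u + 1           ≤⟨ +-monoʳ-≤ (degree G u) (Adj⇒1≤degree G (Adj-sym G uv)) ⟩
    degree G u + degree G v  ≡⟨ degree-H-u ⟨
    degree H u + 1           ∎)
    where open ≤-Reasoning

  degree-G-v≤H-u : degree G v ≤ degree H u
  degree-G-v≤H-u = +-cancelʳ-≤ 1 _ _ (begin
    degree G v + 1           ≤⟨ +-monoʳ-≤ (degree G v) (Adj⇒1≤degree G uv) ⟩
    degree G v + degree G u  ≡⟨ +-comm (degree G v) (degree G u) ⟩
    degree G u + degree G v  ≡⟨ degree-H-u ⟨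
    degree H u + 1           ∎)
    where open ≤-Reasoning

  weight-uv-≤ : weight G u v ≤ weight H u v
  weight-uv-≤ = subst (λ d → weight G u v ≤ degree H u * degree H u + d * d) (sym degree-H-v)
    (a²+b²≤c²+1 (Adj⇒1≤degree G uv) (Adj⇒1≤degree G (Adj-sym G uv)) degree-H-u)

  degree-G≤H-other : ∀ {j} → j ≢ u → j ≢ v → degree G j ≤ degree H j
  degree-G≤H-other j≢u j≢v = ≤-reflexive (sym (degree-H-other j≢u j≢v))

  module _ (N : ℕ) where

    edgeTerm-uv-≤ : edgeTerm N G u v ≤ edgeTerm N H u v
    edgeTerm-uv-≤ = rootIf-mono N (λ _ → H-adj-uv) weight-uv-≤

    edgeTerm-vu-≤ : edgeTerm N G v u ≤ edgeTerm N H v u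
    edgeTerm-vu-≤ = subst₂ _≤_ (edgeTerm-sym N G u v) (edgeTerm-sym N H u v) edgeTerm-uv-≤

    RowsUVColumn-≤ : Fin n → Set
    RowsUVColumn-≤ j = edgeTerm N G u j + edgeTerm N G v j ≤ edgeTerm N H u j + edgeTerm N H v j

    rows-uv-column-≤ : ∀ j → RowsUVColumn-≤ j
    rows-uv-column-≤ j = by-role (role j)
      where
      by-role : Role j → RowsUVColumn-≤ j
      by-role (is-u j≡u) = subst RowsUVColumn-≤ (sym j≡u) (+-mono-≤ (edgeTerm-diag-≤ N G H u u) edgeTerm-vu-≤)
      by-role (is-v j≡v) = subst RowsUVColumn-≤ (sym j≡v) (+-mono-≤ edgeTerm-uv-≤ (edgeTerm-diag-≤ N G H v v))
      by-role (other j≢u j≢v) = begin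
        edgeTerm N G u j + edgeTerm N G v j
          ≤⟨ rootIf-∨ N no-common (sum-of-squares-mono degree-G-u≤H-u (degree-G≤H-other j≢u j≢v))
                                  (sum-of-squares-mono degree-G-v≤H-u (degree-G≤H-other j≢u j≢v)) ⟩
        rootIf N (adj G u j ∨ adj G v j) (weight H u j)
          ≡⟨ +-identityʳ _ ⟨
        rootIf N (adj G u j ∨ adj G v j) (weight H u j) + 0
          ≡⟨ cong₂ (λ a b → rootIf N a (weight H u j) + rootIf N b (weight H v j))
                   (H-adj-u-other j≢u j≢v) (trans (Graph.sym H v j) (H-adj-other-v j≢u)) ⟨
        edgeTerm N H u j + edgeTerm N H v j ∎
        where open ≤-Reasoning

    row-other-≤ : ∀ i → i ≢ u → i ≢ v → sum (edgeTerm N G i) ≤ sum (edgeTerm N H i)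
    row-other-≤ i i≢u i≢v =
      subst₂ _≤_ (+-identityʳ _) (+-identityʳ _) (sum-mono-≤-except₂ u≢v (+-monoˡ-≤ 0 at-uv) elsewhere)
      where
      open ≤-Reasoning
      at-uv : edgeTerm N G i u + edgeTerm N G i v ≤ edgeTerm N H i u + edgeTerm N H i v
      at-uv = begin
        edgeTerm N G i u + edgeTerm N G i v
          ≤⟨ rootIf-∨ N no-common′ (sum-of-squares-mono (degree-G≤H-other i≢u i≢v) degree-G-u≤H-u)
                                             (sum-of-squares-mono (degree-G≤H-other i≢u i≢v) degree-G-v≤H-u) ⟩
        rootIf N (adj G i u ∨ adj G i v) (weight H i u)
          ≡⟨ +-identityʳ _ ⟨
        rootIf N (adj G i u ∨ adj G i v) (weight H i u) + 0
          ≡⟨ cong₂ (λ a b → rootIf N a (weight H i u) + rootIf N b (weight H i v))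
                   (H-adj-other-u i≢u i≢v) (H-adj-other-v i≢u) ⟨
        edgeTerm N H i u + edgeTerm N H i v ∎
      elsewhere : ∀ j → j ≢ u → j ≢ v → edgeTerm N G i j ≤ edgeTerm N H i j
      elsewhere j j≢u j≢v = ≤-reflexive (cong₂ (rootIf N) (sym (H-adj-other i≢u i≢v j≢u j≢v))
        (cong₂ (λ a b → a * a + b * b) (sym (degree-H-other i≢u i≢v)) (sym (degree-H-other j≢u j≢v))))

    ∑∑-edgeTerm-gain : ∀ {x} C → Adj G u x → x ≢ v →
      scaledRoot N (weight G u x) + C ≤ scaledRoot N (weight H u x) →
      ∑[ i < n ] ∑[ j < n ] edgeTerm N G i j + C ≤ ∑[ i < n ] ∑[ j < n ] edgeTerm N H i j + 0
    ∑∑-edgeTerm-gain {x} C ux x≢v gain = sum-mono-≤-except₂ u≢v rows-uv row-other-≤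
      where
      open ≤-Reasoning
      x≢u : x ≢ u
      x≢u = Adj⇒≢ G (Adj-sym G ux)
      column-x : edgeTerm N G u x + edgeTerm N G v x + C ≤ edgeTerm N H u x + edgeTerm N H v x + 0
      column-x = begin
        edgeTerm N G u x + edgeTerm N G v x + C
          ≡⟨ cong₂ (λ a b → rootIf N a (weight G u x) + rootIf N b (weight G v x) + C)
                   ux (adj-false G (no-common ux)) ⟩
        scaledRoot N (weight G u x) + 0 + C  ≡⟨ cong (_+ C) (+-identityʳ _) ⟩
        scaledRoot N (weight G u x) + C      ≤⟨ gain ⟩
        scaledRoot N (weight H u x)          ≡⟨ trans (+-identityʳ _) (+-identityʳ _) ⟨
        scaledRoot N (weight H u x) + 0 + 0
          ≡⟨ cong₂ (λ a b → rootIf N a (weight H u x) + rootIf N b (weight H v x) + 0)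
                   (trans (H-adj-u-other x≢u x≢v) (cong (_∨ adj G v x) ux))
                   (trans (Graph.sym H v x) (H-adj-other-v x≢u)) ⟨
        edgeTerm N H u x + edgeTerm N H v x + 0 ∎
      rows-uv : sum (edgeTerm N G u) + sum (edgeTerm N G v) + C ≤ sum (edgeTerm N H u) + sum (edgeTerm N H v) + 0
      rows-uv = begin
        sum (edgeTerm N G u) + sum (edgeTerm N G v) + C
          ≡⟨ cong (_+ C) (∑-distrib-+ (edgeTerm N G u) (edgeTerm N G v)) ⟨
        ∑[ j < n ] (edgeTerm N G u j + edgeTerm N G v j) + C
          ≤⟨ sum-mono-≤-except x column-x (λ j _ → rows-uv-column-≤ j) ⟩
        ∑[ j < n ] (edgeTerm N H u j + edgeTerm N H v j) + 0
          ≡⟨ cong (_+ 0) (∑-distrib-+ (edgeTerm N H u) (edgeTerm N H v)) ⟩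
        sum (edgeTerm N H u) + sum (edgeTerm N H v) + 0 ∎

  degree-G-u<H-u : 2 ≤ degree G v → degree G u < degree H u
  degree-G-u<H-u 2≤dv = +-cancelʳ-≤ 1 _ _ (begin
    suc (degree G u) + 1     ≡⟨ +-comm (suc (degree G u)) 1 ⟩
    suc (suc (degree G u))   ≡⟨ +-comm (degree G u) 2 ⟨
    degree G u + 2           ≤⟨ +-monoʳ-≤ (degree G u) 2≤dv ⟩
    degree G u + degree G v  ≡⟨ degree-H-u ⟨
    degree H u + 1           ∎)
    where open ≤-Reasoning

  -- H ≤SO G tolerates an excess of one unit per edge of G; the doubled sums gain 2m + 1.
  ¬H≤SOG : ∀ {x} → 2 ≤ degree G v → Adj G u x → x ≢ v → ¬ (H ≤SO G)
  ¬H≤SOG {x} 2≤dv ux x≢v H≤SOG = <-irrefl refl (+-cancelˡ-≤ (2 * SG) _ _ (begin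
    2 * SG + C                                     ≡⟨ cong (_+ C) (approxSO-as-∑∑ N G) ⟩
    ∑[ i < n ] ∑[ j < n ] edgeTerm N G i j + C     ≤⟨ ∑∑-edgeTerm-gain N C ux x≢v gain ⟩
    ∑[ i < n ] ∑[ j < n ] edgeTerm N H i j + 0     ≡⟨ trans (+-identityʳ _) (sym (approxSO-as-∑∑ N H)) ⟩
    2 * SH                                         ≤⟨ *-monoʳ-≤ 2 (H≤SOG N) ⟩
    2 * (SG + m)                                   ≡⟨ *-distribˡ-+ 2 SG m ⟩
    2 * SG + 2 * m                                 ∎))
    where
    open ≤-Reasoning
    m = List.length (edgeWeights G)
    C = suc (2 * m)
    x≢u : x ≢ u
    x≢u = Adj⇒≢ G (Adj-sym G ux)
    weight-ux-< : weight G u x < weight H u x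
    weight-ux-< = +-mono-<-≤ (*-mono-< (degree-G-u<H-u 2≤dv) (degree-G-u<H-u 2≤dv))
                             (*-mono-≤ (degree-G≤H-other x≢u x≢v) (degree-G≤H-other x≢u x≢v))
    N = proj₁ (scaledRoot-gap C weight-ux-<)
    gain = proj₂ (scaledRoot-gap C weight-ux-<)
    SG = approxSO N (edgeWeights G)
    SH = approxSO N (edgeWeights H)

  -- The edge ab of G corresponds to the edge (redirect a b , redirect b a) of H.
  redirect : Fin n → Fin n → Fin n
  redirect a b with a ≟ v | b ≟ u
  ... | yes _ | no _ = u
  ... | _     | _    = a

  redirect-≢v : ∀ {a b} → a ≢ v → redirect a b ≡ a
  redirect-≢v {a} {b} a≢v with a ≟ v | b ≟ u
  ... | yes a≡v | _ = ⊥-elim (a≢v a≡v)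
  ... | no _    | _ = refl

  redirect-vu : redirect v u ≡ v
  redirect-vu with v ≟ v | u ≟ u
  ... | yes _   | yes _   = refl
  ... | yes _   | no u≢u  = ⊥-elim (u≢u refl)
  ... | no v≢v  | _       = ⊥-elim (v≢v refl)

  redirect-v≢u : ∀ {b} → b ≢ u → redirect v b ≡ u
  redirect-v≢u {b} b≢u with v ≟ v | b ≟ u
  ... | yes _  | no _    = refl
  ... | yes _  | yes b≡u = ⊥-elim (b≢u b≡u)
  ... | no v≢v | _       = ⊥-elim (v≢v refl)

  redirect-uv : redirect u v ≡ u
  redirect-uv = redirect-≢v u≢v

  data EdgeView (a b : Fin n) : Set where
    tail-moved : a ≡ v → b ≢ u → redirect a b ≡ u → redirect b a ≡ b → EdgeView a b
    head-moved : b ≡ v → a ≢ u → redirect a b ≡ a → redirect b a ≡ u → EdgeView a b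
    unmoved    : redirect a b ≡ a → redirect b a ≡ b → EdgeView a b

  edgeView : ∀ {a b} → Adj G a b → EdgeView a b
  edgeView {a} {b} ab with a ≟ v | b ≟ v
  ... | yes refl | _ with b ≟ u
  ...   | yes refl = unmoved redirect-vu redirect-uv
  ...   | no b≢u   = tail-moved refl b≢u (redirect-v≢u b≢u) (redirect-≢v (Adj⇒≢ G (Adj-sym G ab)))
  edgeView {a} {b} ab | no a≢v | yes refl with a ≟ u
  ...   | yes refl = unmoved redirect-uv redirect-vu
  ...   | no a≢u   = head-moved refl a≢u (redirect-≢v a≢v) (redirect-v≢u a≢u)
  edgeView {a} {b} ab | no a≢v | no b≢v = unmoved (redirect-≢v a≢v) (redirect-≢v b≢v)

  redirect-Adj : ∀ {a b} → Adj G a b → Adj H (redirect a b) (redirect b a)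
  redirect-Adj {a} {b} = by-roles (role a) (role b)
    where
    H-adj-u : ∀ {b} → b ≢ u → b ≢ v → Adj G u b ⊎ Adj G v b → Adj H u b
    H-adj-u {b} b≢u b≢v (inj₁ ub) = trans (H-adj-u-other b≢u b≢v) (cong (_∨ adj G v b) ub)
    H-adj-u {b} b≢u b≢v (inj₂ vb) = trans (H-adj-u-other b≢u b≢v) (trans (cong (adj G u b ∨_) vb) (Boolₚ.∨-zeroʳ _))
    by-roles : ∀ {a b} → Role a → Role b → Adj G a b → Adj H (redirect a b) (redirect b a)
    by-roles (is-u refl) (is-u refl) uu = ⊥-elim (Adj⇒≢ G uu refl)
    by-roles (is-v refl) (is-v refl) vv = ⊥-elim (Adj⇒≢ G vv refl)
    by-roles (is-u refl) (is-v refl) _  = subst₂ (Adj H) (sym redirect-uv) (sym redirect-vu) H-adj-uv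
    by-roles (is-v refl) (is-u refl) _  =
      subst₂ (Adj H) (sym redirect-vu) (sym redirect-uv) (Adj-sym H {u} {v} H-adj-uv)
    by-roles {b = b} (is-u refl) (other b≢u b≢v) ub =
      subst₂ (Adj H) (sym (redirect-≢v {b = b} u≢v)) (sym (redirect-≢v b≢v)) (H-adj-u b≢u b≢v (inj₁ ub))
    by-roles {b = b} (is-v refl) (other b≢u b≢v) vb =
      subst₂ (Adj H) (sym (redirect-v≢u b≢u)) (sym (redirect-≢v {b = v} b≢v)) (H-adj-u b≢u b≢v (inj₂ vb))
    by-roles {a} (other a≢u a≢v) (is-u refl) au =
      Adj-sym H {redirect u a} {redirect a u} (by-roles (is-u refl) (other a≢u a≢v) (Adj-sym G au))
    by-roles {a} (other a≢u a≢v) (is-v refl) av =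
      Adj-sym H {redirect v a} {redirect a v} (by-roles (is-v refl) (other a≢u a≢v) (Adj-sym G av))
    by-roles {a} {b} (other a≢u a≢v) (other b≢u b≢v) ab =
      subst₂ (Adj H) (sym (redirect-≢v {b = b} a≢v)) (sym (redirect-≢v {b = a} b≢v))
        (trans (H-adj-other a≢u a≢v b≢u b≢v) ab)

  redirect-injective : ∀ {a b c d} → Adj G a b → Adj G c d →
    redirect a b ≡ redirect c d → redirect b a ≡ redirect d c → a ≡ c × b ≡ d
  redirect-injective {a} {b} {c} {d} ab cd e₁ e₂ = by-views (edgeView ab) (edgeView cd)
    where
    link : ∀ {p q x y : Fin n} → p ≡ x → p ≡ q → q ≡ y → x ≡ y
    link r e r′ = trans (sym r) (trans e r′)
    common : ∀ {x y w} → x ≡ u → y ≡ v → Adj G x w → Adj G y w → ⊥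
    common refl refl = no-common
    by-views : EdgeView a b → EdgeView c d → a ≡ c × b ≡ d
    by-views (tail-moved a≡v _ _ r₂) (tail-moved c≡v _ _ r₂′) = trans a≡v (sym c≡v) , link r₂ e₂ r₂′
    by-views (head-moved b≡v _ r₁ _) (head-moved d≡v _ r₁′ _) = link r₁ e₁ r₁′ , trans b≡v (sym d≡v)
    by-views (unmoved r₁ r₂)         (unmoved r₁′ r₂′)        = link r₁ e₁ r₁′ , link r₂ e₂ r₂′
    by-views (tail-moved _ _ r₁ _)   (head-moved _ c≢u r₁′ _) = ⊥-elim (c≢u (link r₁′ (sym e₁) r₁))
    by-views (head-moved _ _ _ r₂)   (tail-moved _ d≢u _ r₂′) = ⊥-elim (d≢u (link r₂′ (sym e₂) r₂))
    by-views (tail-moved a≡v _ r₁ r₂) (unmoved r₁′ r₂′) =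
      ⊥-elim (common (link r₁′ (sym e₁) r₁) a≡v (subst (Adj G c) (link r₂′ (sym e₂) r₂) cd) ab)
    by-views (unmoved r₁ r₂) (tail-moved c≡v _ r₁′ r₂′) =
      ⊥-elim (common (link r₁ e₁ r₁′) c≡v (subst (Adj G a) (link r₂ e₂ r₂′) ab) cd)
    by-views (head-moved b≡v _ r₁ r₂) (unmoved r₁′ r₂′) =
      ⊥-elim (common (link r₂′ (sym e₂) r₂) b≡v (subst (Adj G d) (link r₁′ (sym e₁) r₁) (Adj-sym G cd)) (Adj-sym G ab))
    by-views (unmoved r₁ r₂) (head-moved d≡v _ r₁′ r₂′) =
      ⊥-elim (common (link r₂ e₂ r₂′) d≡v (subst (Adj G b) (link r₁ e₁ r₁′) (Adj-sym G ab)) (Adj-sym G cd))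

  Preimage : Fin n → Fin n → Set
  Preimage s t = ∃ λ c → ∃ λ d → Adj G c d × redirect c d ≡ s × redirect d c ≡ t

  redirect-onto : ∀ {s t} → Adj H s t → Preimage s t
  redirect-onto {s} {t} = by-roles (role s) (role t)
    where
    flip : ∀ {s t} → Preimage s t → Preimage t s
    flip (c , d , cd , r₁ , r₂) = d , c , Adj-sym G cd , r₂ , r₁
    by-roles : ∀ {s t} → Role s → Role t → Adj H s t → Preimage s t
    by-roles (is-u refl) (is-u refl) uu = ⊥-elim (Adj⇒≢ H {u} {u} uu refl)
    by-roles (is-v refl) (is-v refl) vv = ⊥-elim (Adj⇒≢ H {v} {v} vv refl)
    by-roles (is-u refl) (is-v refl) _  = u , v , uv , redirect-uv , redirect-vu
    by-roles (is-v refl) (is-u refl) _  = v , u , Adj-sym G uv , redirect-vu , redirect-uv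
    by-roles (is-v refl) (other t≢u _) vt = ⊥-elim (t≢u (H-adj-v vt))
    by-roles {s} (other s≢u _) (is-v refl) sv = ⊥-elim (s≢u (H-adj-v (Adj-sym H {s} {v} sv)))
    by-roles {t = t} (is-u refl) (other t≢u t≢v) ut with ∨≡true⇒⊎ (trans (sym (H-adj-u-other t≢u t≢v)) ut)
    ... | inj₁ ut′ = u , t , ut′ , redirect-≢v u≢v , redirect-≢v t≢v
    ... | inj₂ vt  = v , t , vt , redirect-v≢u t≢u , redirect-≢v t≢v
    by-roles {s} (other s≢u s≢v) (is-u refl) su = flip (by-roles (is-u refl) (other s≢u s≢v) (Adj-sym H {s} {u} su))
    by-roles {s} {t} (other s≢u s≢v) (other t≢u t≢v) st =
      s , t , trans (sym (H-adj-other s≢u s≢v t≢u t≢v)) st , redirect-≢v s≢v , redirect-≢v t≢v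

  module _ (S : Fin n → Fin n → Set) (S-uv : S u v) (S-vu : S v u) where

    path-from-redirected : ∀ {a b} → Adj G a b → S (redirect a b) (redirect b a) → Star S a b
    path-from-redirected ab s with edgeView ab
    ... | tail-moved refl _ r₁ r₂ = S-vu ◅ subst₂ S r₁ r₂ s ◅ ε
    ... | head-moved refl _ r₁ r₂ = subst₂ S r₁ r₂ s ◅ S-uv ◅ ε
    ... | unmoved r₁ r₂           = subst₂ S r₁ r₂ s ◅ ε

    path-to-redirected : ∀ {a b} → Adj G a b → S a b → Star S (redirect a b) (redirect b a)
    path-to-redirected ab s with edgeView ab
    ... | tail-moved refl _ r₁ r₂ = subst₂ (Star S) (sym r₁) (sym r₂) (S-uv ◅ s ◅ ε)
    ... | head-moved refl _ r₁ r₂ = subst₂ (Star S) (sym r₁) (sym r₂) (s ◅ S-vu ◅ ε)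
    ... | unmoved r₁ r₂           = subst₂ (Star S) (sym r₁) (sym r₂) (s ◅ ε)

  H-connected : Connected G → Connected H
  H-connected conn x y = (lift ⋆) (conn x y)
    where
    lift : ∀ {a b} → Adj G a b → Star (Adj H) a b
    lift ab = path-from-redirected (Adj H) H-adj-uv (Adj-sym H {u} {v} H-adj-uv) ab (redirect-Adj ab)

  SameEdge-redirect : ∀ {a b c d} → SameEdge c d a b →
    SameEdge (redirect c d) (redirect d c) (redirect a b) (redirect b a)
  SameEdge-redirect (inj₁ (refl , refl)) = inj₁ (refl , refl)
  SameEdge-redirect (inj₂ (refl , refl)) = inj₂ (refl , refl)

  redirect-SameEdge : ∀ {a b c d} → Adj G a b → Adj G c d →
    SameEdge (redirect c d) (redirect d c) (redirect a b) (redirect b a) → SameEdge c d a b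
  redirect-SameEdge ab cd (inj₁ (e₁ , e₂)) = inj₁ (redirect-injective ab cd e₁ e₂)
  redirect-SameEdge ab cd (inj₂ (e₁ , e₂)) = inj₂ (redirect-injective ab (Adj-sym G cd) e₁ e₂)

  connectedWithout-H⇒G : ∀ {c d} → Adj G c d → ¬ SameEdge u v c d →
    ConnectedWithout H (redirect c d) (redirect d c) → ConnectedWithout G c d
  connectedWithout-H⇒G {c} {d} cd ¬uv conn x y = (lower ⋆) (conn x y)
    where
    ¬uv′ : ¬ SameEdge c d u v
    ¬uv′ = ¬uv ∘ SameEdge-comm
    lower : ∀ {s t} → AdjMinus H (redirect c d) (redirect d c) s t → Star (AdjMinus G c d) s t
    lower {s} {t} (st , ¬cd) with redirect-onto {s} {t} st
    ... | a , b , ab , refl , refl =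
      path-to-redirected (AdjMinus G c d) (uv , ¬uv′) (Adj-sym G uv , ¬uv′ ∘ SameEdge-flip) ab
        (ab , ¬cd ∘ SameEdge-redirect)

  connectedWithout-G⇒H : ∀ {c d} → Adj G c d → ¬ SameEdge u v c d →
    ConnectedWithout G c d → ConnectedWithout H (redirect c d) (redirect d c)
  connectedWithout-G⇒H {c} {d} cd ¬uv conn x y = (lift ⋆) (conn x y)
    where
    ¬uv′ : ¬ SameEdge (redirect c d) (redirect d c) u v
    ¬uv′ same = ¬uv (SameEdge-comm (redirect-SameEdge uv cd
                  (subst₂ (SameEdge (redirect c d) (redirect d c)) (sym redirect-uv) (sym redirect-vu) same)))
    lift : ∀ {a b} → AdjMinus G c d a b → Star (AdjMinus H (redirect c d) (redirect d c)) a b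
    lift (ab , ¬cd) =
      path-from-redirected (AdjMinus H (redirect c d) (redirect d c))
        (H-adj-uv , ¬uv′) (Adj-sym H {u} {v} H-adj-uv , ¬uv′ ∘ SameEdge-flip) ab
        (redirect-Adj ab , ¬cd ∘ redirect-SameEdge ab cd)

  H-cut-uv : IsCutEdge H u v
  H-cut-uv = IsCutEdge-sym H {v} {u} (leaf-IsCutEdge H {v} {u} (Adj-sym H {u} {v} H-adj-uv) H-adj-v)

  redirect-preserves-cut : ∀ {c d} → IsCutEdge G c d → IsCutEdge H (redirect c d) (redirect d c)
  redirect-preserves-cut {c} {d} (cd , ¬conn) with sameEdge? u v c d
  ... | yes (inj₁ (refl , refl)) = subst₂ (IsCutEdge H) (sym redirect-uv) (sym redirect-vu) H-cut-uv
  ... | yes (inj₂ (refl , refl)) =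
    subst₂ (IsCutEdge H) (sym redirect-vu) (sym redirect-uv) (IsCutEdge-sym H {u} {v} H-cut-uv)
  ... | no ¬uv = redirect-Adj cd , ¬conn ∘ connectedWithout-H⇒G cd ¬uv

  redirect-reflects-cut : IsCutEdge G u v →
    ∀ {c d} → Adj G c d → IsCutEdge H (redirect c d) (redirect d c) → IsCutEdge G c d
  redirect-reflects-cut cut-uv {c} {d} cd (_ , ¬conn) with sameEdge? u v c d
  ... | yes (inj₁ (refl , refl)) = cut-uv
  ... | yes (inj₂ (refl , refl)) = IsCutEdge-sym G cut-uv
  ... | no ¬uv                   = cd , ¬conn ∘ connectedWithout-G⇒H cd ¬uv

  H-HasCutEdges : IsCutEdge G u v → ∀ {k} → HasCutEdges G k → HasCutEdges H k
  H-HasCutEdges cut-uv = HasPairs-transfer redirect (IsCutEdge-sym G) (λ {s} {t} → Adj⇒≢ H {s} {t} ∘ proj₁)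
    redirect-preserves-cut (λ ab cd → redirect-injective (proj₁ ab) (proj₁ cd)) cut-preimage
    where
    cut-preimage : ∀ {s t} → IsCutEdge H s t →
      ∃ λ c → ∃ λ d → IsCutEdge G c d × redirect c d ≡ s × redirect d c ≡ t
    cut-preimage {s} {t} st with redirect-onto {s} {t} (proj₁ st)
    ... | c , d , cd , refl , refl = c , d , redirect-reflects-cut cut-uv cd st , refl , refl

proposition3p2 : (n k : ℕ) (G : Graph n) → Connected G → HasCutEdges G k →
    ((H : Graph n) → Connected H → HasCutEdges H k → H ≤SO G) →
    ∀ u v → IsCutEdge G u v → Pendent G u v
proposition3p2 n k G conn hasK maximal u v cut@(uv , _) with degree G u ℕ.≟ 1 | degree G v ℕ.≟ 1
... | yes du≡1 | _        = inj₁ du≡1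
... | no _     | yes dv≡1 = inj₂ dv≡1
... | no du≢1  | no dv≢1  with degree≢1⇒other-neighbour G uv du≢1
...   | x , ux , x≢v = ⊥-elim (¬H≤SOG 2≤dv ux x≢v (maximal H (H-connected conn) (H-HasCutEdges cut hasK)))
  where
  open Slide G uv (IsCutEdge⇒no-common-neighbour G conn cut)
  2≤dv : 2 ≤ degree G v
  2≤dv = ≤∧≢⇒< (Adj⇒1≤degree G (Adj-sym G uv)) (dv≢1 ∘ sym)
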